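{- Let $n\ge 1$ and $0\le r\le n$, $1\le k\le n$ be integers such that there exist $x_1,x_2,x_3\in\{0,1\}^n$ with pairwise Hamming distances at least $k$. Consider the maximum $$N_r^{(n)}(3,k)=\max_{\substack{x_1,x_2,x_3\in\{0,1\}^n\\ d(x_i,x_j)\ge k,\ i\ne j}}\left|B_r(x_1)\cap B_r(x_2)\cap B_r(x_3)\right|.$$ If $k=2t$ is even, this maximum is attained by a triple of centers satisfying $d(x_1,x_2)=d(x_1,x_3)=d(x_2,x_3)=k$. If $k$ is odd, the maximum is attained by a triple whose pairwise distances are $k,k,k+1$, up to permutation.
   Context: $d(\cdot,\cdot)$ denotes the Hamming distance on $\{0,1\}^n$, and $B_r(x)=\{y\in\{0,1\}^n: d(x,y)\le r\}$ is the Hamming ball of radius $r$ centered at $x$. -}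

module Defs where

open import Data.Bool using (Bool; true; false)
open import Data.Nat using (ℕ; zero; suc; _+_; _≤_; _≥_; _≤?_)
open import Data.Vec using (Vec; []; _∷_)
open import Data.List using (List; []; _∷_; map; _++_; length; filter)
open import Data.Product using (_×_)
open import Relation.Nullary.Decidable using (_×-dec_)

hamming : ∀ {n} → Vec Bool n → Vec Bool n → ℕ
hamming [] [] = 0
hamming (true ∷ xs) (true ∷ ys) = hamming xs ys
hamming (false ∷ xs) (false ∷ ys) = hamming xs ys
hamming (true ∷ xs) (false ∷ ys) = suc (hamming xs ys)
hamming (false ∷ xs) (true ∷ ys) = suc (hamming xs ys)

allVecs : (n : ℕ) → List (Vec Bool n)
allVecs zero = [] ∷ []
allVecs (suc n) = map (false ∷_) (allVecs n) ++ map (true ∷_) (allVecs n)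

tripleBallCount : ∀ {n} → ℕ → Vec Bool n → Vec Bool n → Vec Bool n → ℕ
tripleBallCount {n} r x₁ x₂ x₃ =
  length (filter (λ y → (hamming x₁ y ≤? r) ×-dec ((hamming x₂ y ≤? r) ×-dec (hamming x₃ y ≤? r))) (allVecs n))

Admissible : ∀ {n} → ℕ → Vec Bool n → Vec Bool n → Vec Bool n → Set
Admissible k x₁ x₂ x₃ = hamming x₁ x₂ ≥ k × hamming x₁ x₃ ≥ k × hamming x₂ x₃ ≥ k

IsMaximizer : ∀ {n} → ℕ → ℕ → Vec Bool n → Vec Bool n → Vec Bool n → Set
IsMaximizer {n} r k x₁ x₂ x₃ =
  Admissible k x₁ x₂ x₃ ×
  ((y₁ y₂ y₃ : Vec Bool n) → Admissible k y₁ y₂ y₃ →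
     tripleBallCount r y₁ y₂ y₃ ≤ tripleBallCount r x₁ x₂ x₃)

{-# OPTIONS --safe #-}

-- Classify each coordinate of a triple (x₁, x₂, x₃) by which centre, if any, disagrees with the other
-- two, and let (a, o₁, o₂, o₃) count the coordinates of each kind. Then d(xᵢ, xⱼ) = oᵢ + oⱼ, and
-- counting the points y coordinate by coordinate gives
--   |B_r(x₁) ∩ B_r(x₂) ∩ B_r(x₃)| = (T_agree^a T_odd₁^o₁ T_odd₂^o₂ T_odd₃^o₃ 1_[0,r]³)(0),
-- where a column m ∈ {0,1}³ acts on h : ℕ³ → ℕ by (T_m h)(u) = h(u + m) + h(u + 1 − m).
-- The indicator of the box [0,r]³ is supermodular on the lattice ℕ³ and every T_m preserves
-- supermodularity; applied to the two offsets of T_m, supermodularity gives T_m h ≤ T_agree h, and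
-- applied to the middle offsets of T_odd₂ T_odd₃ it gives T_odd₂ T_odd₃ h ≤ T_agree T_odd₁ h.
-- Hence the count can only grow when an odd column becomes an agreeing one, or when an odd₂ and an
-- odd₃ column become an agreeing and an odd₁ column. Once the centres are labelled so that d(x₂, x₃)
-- is the largest distance, these moves lead from every admissible profile to (n − 3t, t, t, t) if
-- k = 2t, and to (n − 3t − 2, t, t + 1, t + 1) if k = 2t + 1; these profiles have distances k, k, k
-- and k, k, k + 1, and any triple realising them is therefore a maximiser.

module Submission where

open import Defs
open import Data.Bool using (Bool; true; false; not; _xor_)
open import Data.Bool.Properties using (not-involutive)
open import Data.Empty using (⊥-elim)
open import Data.List using (List; []; _∷_; map; _++_; length; filter)
open import Data.List.Properties using (length-++; filter-++; filter-≐)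
open import Data.Nat
  using ( ℕ; zero; suc; _+_; _*_; _≤_; _<_; _≤?_; _⊓_; _⊔_; z≤n; s≤s
        ; _≤′_; ≤′-refl; ≤′-step; _≤‴_; ≤‴-refl; ≤‴-step )
open import Data.Nat.Properties
open import Algebra.Properties.CommutativeSemigroup +-commutativeSemigroup
  using (interchange; xy∙z≈xz∙y)
open import Data.Product using (_×_; _,_; ∃-syntax; map₂)
open import Data.Sum using (_⊎_; inj₁; inj₂)
open import Data.Vec using (Vec; []; _∷_)
open import Function using (_∘_)
open import Relation.Binary.Construct.Closure.ReflexiveTransitive using (Star; ε; _◅_)
open import Relation.Binary.PropositionalEquality
open import Relation.Nullary using (Dec; yes; no; does; ¬_; contradiction)
open import Relation.Nullary.Decidable using (_×-dec_; dec-true; dec-false)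

ℕ³ : Set
ℕ³ = ℕ × ℕ × ℕ

0³ : ℕ³
0³ = (0 , 0 , 0)

infixl 6 _⊕_ _⊔³_
infixl 7 _⊓³_

_⊕_ _⊓³_ _⊔³_ : ℕ³ → ℕ³ → ℕ³
(a₁ , a₂ , a₃) ⊕ (b₁ , b₂ , b₃) = (a₁ + b₁ , a₂ + b₂ , a₃ + b₃)
(a₁ , a₂ , a₃) ⊓³ (b₁ , b₂ , b₃) = (a₁ ⊓ b₁ , a₂ ⊓ b₂ , a₃ ⊓ b₃)
(a₁ , a₂ , a₃) ⊔³ (b₁ , b₂ , b₃) = (a₁ ⊔ b₁ , a₂ ⊔ b₂ , a₃ ⊔ b₃)

cong³ : ∀ {a₁ a₂ a₃ b₁ b₂ b₃ : ℕ} → a₁ ≡ b₁ → a₂ ≡ b₂ → a₃ ≡ b₃ →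
        (a₁ , a₂ , a₃) ≡ (b₁ , b₂ , b₃)
cong³ refl refl refl = refl

⊕-assoc : ∀ u v w → u ⊕ v ⊕ w ≡ u ⊕ (v ⊕ w)
⊕-assoc (u₁ , u₂ , u₃) (v₁ , v₂ , v₃) (w₁ , w₂ , w₃) =
  cong³ (+-assoc u₁ v₁ w₁) (+-assoc u₂ v₂ w₂) (+-assoc u₃ v₃ w₃)

⊕-swapʳ : ∀ u v w → u ⊕ v ⊕ w ≡ u ⊕ w ⊕ v
⊕-swapʳ (u₁ , u₂ , u₃) (v₁ , v₂ , v₃) (w₁ , w₂ , w₃) =
  cong³ (xy∙z≈xz∙y u₁ v₁ w₁) (xy∙z≈xz∙y u₂ v₂ w₂) (xy∙z≈xz∙y u₃ v₃ w₃)

⊕-identityʳ : ∀ u → u ⊕ 0³ ≡ u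
⊕-identityʳ (u₁ , u₂ , u₃) = cong³ (+-identityʳ u₁) (+-identityʳ u₂) (+-identityʳ u₃)

⊕-distribˡ-⊓³ : ∀ u v w → u ⊕ (v ⊓³ w) ≡ (u ⊕ v) ⊓³ (u ⊕ w)
⊕-distribˡ-⊓³ (u₁ , u₂ , u₃) (v₁ , v₂ , v₃) (w₁ , w₂ , w₃) =
  cong³ (+-distribˡ-⊓ u₁ v₁ w₁) (+-distribˡ-⊓ u₂ v₂ w₂) (+-distribˡ-⊓ u₃ v₃ w₃)

⊕-distribˡ-⊔³ : ∀ u v w → u ⊕ (v ⊔³ w) ≡ (u ⊕ v) ⊔³ (u ⊕ w)
⊕-distribˡ-⊔³ (u₁ , u₂ , u₃) (v₁ , v₂ , v₃) (w₁ , w₂ , w₃) =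
  cong³ (+-distribˡ-⊔ u₁ v₁ w₁) (+-distribˡ-⊔ u₂ v₂ w₂) (+-distribˡ-⊔ u₃ v₃ w₃)

⊕-distribʳ-⊓³ : ∀ u v w → (v ⊓³ w) ⊕ u ≡ (v ⊕ u) ⊓³ (w ⊕ u)
⊕-distribʳ-⊓³ (u₁ , u₂ , u₃) (v₁ , v₂ , v₃) (w₁ , w₂ , w₃) =
  cong³ (+-distribʳ-⊓ u₁ v₁ w₁) (+-distribʳ-⊓ u₂ v₂ w₂) (+-distribʳ-⊓ u₃ v₃ w₃)

⊕-distribʳ-⊔³ : ∀ u v w → (v ⊔³ w) ⊕ u ≡ (v ⊕ u) ⊔³ (w ⊕ u)
⊕-distribʳ-⊔³ (u₁ , u₂ , u₃) (v₁ , v₂ , v₃) (w₁ , w₂ , w₃) =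
  cong³ (+-distribʳ-⊔ u₁ v₁ w₁) (+-distribʳ-⊔ u₂ v₂ w₂) (+-distribʳ-⊔ u₃ v₃ w₃)

record Supermodular (h : ℕ³ → ℕ) : Set where
  constructor supermodular
  field ≤-meet-join : ∀ u v → h u + h v ≤ h (u ⊓³ v) + h (u ⊔³ v)

open Supermodular

infix 4 _≤̇_

_≤̇_ : (ℕ³ → ℕ) → (ℕ³ → ℕ) → Set
f ≤̇ g = ∀ u → f u ≤ g u

module _ {h : ℕ³ → ℕ} (h-super : Supermodular h) where

  supermodular-translateˡ : ∀ s → Supermodular (λ u → h (s ⊕ u))
  supermodular-translateˡ s = supermodular λ u v →
    subst₂ (λ m j → h (s ⊕ u) + h (s ⊕ v) ≤ h m + h j)
      (sym (⊕-distribˡ-⊓³ s u v)) (sym (⊕-distribˡ-⊔³ s u v)) (≤-meet-join h-super (s ⊕ u) (s ⊕ v))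

  supermodular-translateʳ : ∀ s → Supermodular (λ u → h (u ⊕ s))
  supermodular-translateʳ s = supermodular λ u v →
    subst₂ (λ m j → h (u ⊕ s) + h (v ⊕ s) ≤ h m + h j)
      (sym (⊕-distribʳ-⊓³ s u v)) (sym (⊕-distribʳ-⊔³ s u v)) (≤-meet-join h-super (u ⊕ s) (v ⊕ s))

supermodular-+ : ∀ {f g} → Supermodular f → Supermodular g → Supermodular (λ u → f u + g u)
supermodular-+ {f} {g} f-super g-super = supermodular λ u v → begin
  (f u + g u) + (f v + g v)
    ≡⟨ interchange (f u) (g u) (f v) (g v) ⟩
  (f u + f v) + (g u + g v)
    ≤⟨ +-mono-≤ (≤-meet-join f-super u v) (≤-meet-join g-super u v) ⟩
  (f (u ⊓³ v) + f (u ⊔³ v)) + (g (u ⊓³ v) + g (u ⊔³ v))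
    ≡⟨ interchange (f (u ⊓³ v)) (f (u ⊔³ v)) (g (u ⊓³ v)) (g (u ⊔³ v)) ⟩
  (f (u ⊓³ v) + g (u ⊓³ v)) + (f (u ⊔³ v) + g (u ⊔³ v))   ∎
  where open ≤-Reasoning

Column : Set
Column = Bool × Bool × Bool

bit : Bool → ℕ
bit false = 0
bit true = 1

bits : Column → ℕ³
bits (b₁ , b₂ , b₃) = (bit b₁ , bit b₂ , bit b₃)

complement : Column → Column
complement (b₁ , b₂ , b₃) = (not b₁ , not b₂ , not b₃)

diagonal : Column
diagonal = (false , false , false)

column : Column → (ℕ³ → ℕ) → ℕ³ → ℕ
column m h u = h (u ⊕ bits m) + h (u ⊕ bits (complement m))

column-cong : ∀ m {f g} → f ≗ g → column m f ≗ column m g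
column-cong m f≗g u = cong₂ _+_ (f≗g _) (f≗g _)

column-comm : ∀ m m′ h → column m (column m′ h) ≗ column m′ (column m h)
column-comm m m′ h u = begin
  (h (u ⊕ a ⊕ b) + h (u ⊕ a ⊕ b̄)) + (h (u ⊕ ā ⊕ b) + h (u ⊕ ā ⊕ b̄))
    ≡⟨ cong₂ _+_ (cong₂ _+_ (swap a b) (swap a b̄)) (cong₂ _+_ (swap ā b) (swap ā b̄)) ⟩
  (h (u ⊕ b ⊕ a) + h (u ⊕ b̄ ⊕ a)) + (h (u ⊕ b ⊕ ā) + h (u ⊕ b̄ ⊕ ā))
    ≡⟨ interchange (h (u ⊕ b ⊕ a)) (h (u ⊕ b̄ ⊕ a)) (h (u ⊕ b ⊕ ā)) (h (u ⊕ b̄ ⊕ ā)) ⟩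
  (h (u ⊕ b ⊕ a) + h (u ⊕ b ⊕ ā)) + (h (u ⊕ b̄ ⊕ a) + h (u ⊕ b̄ ⊕ ā))   ∎
  where
  open ≡-Reasoning
  a ā b b̄ : ℕ³
  a = bits m
  ā = bits (complement m)
  b = bits m′
  b̄ = bits (complement m′)
  swap : ∀ v w → h (u ⊕ v ⊕ w) ≡ h (u ⊕ w ⊕ v)
  swap v w = cong h (⊕-swapʳ u v w)

column-complement : ∀ m h → column (complement m) h ≗ column m h
column-complement (b₁ , b₂ , b₃) h u
  rewrite not-involutive b₁ | not-involutive b₂ | not-involutive b₃ =
    +-comm (h (u ⊕ bits (not b₁ , not b₂ , not b₃))) (h (u ⊕ bits (b₁ , b₂ , b₃)))

column-column : ∀ m m′ h u → column m (column m′ h) u ≡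
  (h (u ⊕ (bits m ⊕ bits m′)) + h (u ⊕ (bits m ⊕ bits (complement m′)))) +
  (h (u ⊕ (bits (complement m) ⊕ bits m′)) + h (u ⊕ (bits (complement m) ⊕ bits (complement m′))))
column-column m m′ h u =
  cong₂ _+_ (cong₂ _+_ (regroup _ _) (regroup _ _)) (cong₂ _+_ (regroup _ _) (regroup _ _))
  where
  regroup : ∀ v w → h (u ⊕ v ⊕ w) ≡ h (u ⊕ (v ⊕ w))
  regroup v w = cong h (⊕-assoc u v w)

supermodular-column : ∀ m {h} → Supermodular h → Supermodular (column m h)
supermodular-column m h-super = supermodular-+
  (supermodular-translateʳ h-super (bits m)) (supermodular-translateʳ h-super (bits (complement m)))

bits-⊓³-complement : ∀ m → bits m ⊓³ bits (complement m) ≡ bits diagonal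
bits-⊓³-complement (b₁ , b₂ , b₃) = cong³ (bit-⊓-not b₁) (bit-⊓-not b₂) (bit-⊓-not b₃)
  where
  bit-⊓-not : ∀ b → bit b ⊓ bit (not b) ≡ 0
  bit-⊓-not false = refl
  bit-⊓-not true = refl

bits-⊔³-complement : ∀ m → bits m ⊔³ bits (complement m) ≡ bits (complement diagonal)
bits-⊔³-complement (b₁ , b₂ , b₃) = cong³ (bit-⊔-not b₁) (bit-⊔-not b₂) (bit-⊔-not b₃)
  where
  bit-⊔-not : ∀ b → bit b ⊔ bit (not b) ≡ 1
  bit-⊔-not false = refl
  bit-⊔-not true = refl

column-≤-diagonal : ∀ m {h} → Supermodular h → column m h ≤̇ column diagonal h
column-≤-diagonal m {h} h-super u =
  subst₂ (λ v w → column m h u ≤ h (u ⊕ v) + h (u ⊕ w))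
    (bits-⊓³-complement m) (bits-⊔³-complement m)
    (≤-meet-join (supermodular-translateˡ h-super u) (bits m) (bits (complement m)))

Within : ℕ → ℕ³ → Set
Within r (u₁ , u₂ , u₃) = u₁ ≤ r × u₂ ≤ r × u₃ ≤ r

within? : ∀ r u → Dec (Within r u)
within? r (u₁ , u₂ , u₃) = (u₁ ≤? r) ×-dec ((u₂ ≤? r) ×-dec (u₃ ≤? r))

within-⊓³ˡ : ∀ {r} u v → Within r u → Within r (u ⊓³ v)
within-⊓³ˡ (u₁ , u₂ , u₃) (v₁ , v₂ , v₃) (u₁≤r , u₂≤r , u₃≤r) =
  ≤-trans (m⊓n≤m u₁ v₁) u₁≤r , ≤-trans (m⊓n≤m u₂ v₂) u₂≤r , ≤-trans (m⊓n≤m u₃ v₃) u₃≤r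

within-⊓³ʳ : ∀ {r} u v → Within r v → Within r (u ⊓³ v)
within-⊓³ʳ (u₁ , u₂ , u₃) (v₁ , v₂ , v₃) (v₁≤r , v₂≤r , v₃≤r) =
  ≤-trans (m⊓n≤n u₁ v₁) v₁≤r , ≤-trans (m⊓n≤n u₂ v₂) v₂≤r , ≤-trans (m⊓n≤n u₃ v₃) v₃≤r

within-⊔³ : ∀ {r} u v → Within r u → Within r v → Within r (u ⊔³ v)
within-⊔³ (u₁ , u₂ , u₃) (v₁ , v₂ , v₃) (u₁≤r , u₂≤r , u₃≤r) (v₁≤r , v₂≤r , v₃≤r) =
  ⊔-lub u₁≤r v₁≤r , ⊔-lub u₂≤r v₂≤r , ⊔-lub u₃≤r v₃≤r

box : ℕ → ℕ³ → ℕ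
box r u = bit (does (within? r u))

box-within : ∀ {r u} → Within r u → box r u ≡ 1
box-within {r} {u} ru = cong bit (dec-true (within? r u) ru)

box-outside : ∀ {r u} → ¬ Within r u → box r u ≡ 0
box-outside {r} {u} ¬ru = cong bit (dec-false (within? r u) ¬ru)

supermodular-box : ∀ r → Supermodular (box r)
supermodular-box r = supermodular λ u v → cases u v (within? r u) (within? r v)
  where
  cases : ∀ u v → Dec (Within r u) → Dec (Within r v) →
          box r u + box r v ≤ box r (u ⊓³ v) + box r (u ⊔³ v)
  cases u v (yes ru) (yes rv)
    rewrite box-within ru | box-within rv
          | box-within (within-⊓³ˡ u v ru) | box-within (within-⊔³ u v ru rv) = ≤-refl
  cases u v (yes ru) (no ¬rv)
    rewrite box-within ru | box-outside ¬rv | box-within (within-⊓³ˡ u v ru) = s≤s z≤n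
  cases u v (no ¬ru) (yes rv)
    rewrite box-outside ¬ru | box-within rv | box-within (within-⊓³ʳ u v rv) = s≤s z≤n
  cases u v (no ¬ru) (no ¬rv)
    rewrite box-outside ¬ru | box-outside ¬rv = z≤n

-- A column and its complement act alike, so a coordinate is classified by which centre xᵢ, if any,
-- disagrees with the other two there (oddᵢ); the representative has x₁-entry false.
data Kind : Set where
  agree odd₁ odd₂ odd₃ : Kind

representative : Kind → Column
representative agree = (false , false , false)
representative odd₁ = (false , true , true)
representative odd₂ = (false , true , false)
representative odd₃ = (false , false , true)

kind : Column → Kind
kind (false , false , false) = agree
kind (true , true , true) = agree
kind (false , true , true) = odd₁
kind (true , false , false) = odd₁
kind (false , true , false) = odd₂
kind (true , false , true) = odd₂
kind (false , false , true) = odd₃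
kind (true , true , false) = odd₃

⟦_⟧ : Kind → (ℕ³ → ℕ) → ℕ³ → ℕ
⟦ k ⟧ = column (representative k)

column-kind : ∀ m h → column m h ≗ ⟦ kind m ⟧ h
column-kind (false , false , false) h u = refl
column-kind (false , true , true) h u = refl
column-kind (false , true , false) h u = refl
column-kind (false , false , true) h u = refl
column-kind (true , true , true) h = column-complement (representative agree) h
column-kind (true , false , false) h = column-complement (representative odd₁) h
column-kind (true , false , true) h = column-complement (representative odd₂) h
column-kind (true , true , false) h = column-complement (representative odd₃) h

odd₂∘odd₃≤agree∘odd₁ : ∀ {h} → Supermodular h → ⟦ odd₂ ⟧ (⟦ odd₃ ⟧ h) ≤̇ ⟦ agree ⟧ (⟦ odd₁ ⟧ h)
odd₂∘odd₃≤agree∘odd₁ {h} h-super u = begin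
  ⟦ odd₂ ⟧ (⟦ odd₃ ⟧ h) u
    ≡⟨ column-column (representative odd₂) (representative odd₃) h u ⟩
  (h (u ⊕ (0 , 1 , 1)) + h (u ⊕ (1 , 2 , 0))) + (h (u ⊕ (1 , 0 , 2)) + h (u ⊕ (2 , 1 , 1)))
    ≤⟨ middle-≤ (h (u ⊕ (0 , 1 , 1))) (h (u ⊕ (2 , 1 , 1)))
         (≤-meet-join (supermodular-translateˡ h-super u) (1 , 2 , 0) (1 , 0 , 2)) ⟩
  (h (u ⊕ (0 , 1 , 1)) + h (u ⊕ (1 , 0 , 0))) + (h (u ⊕ (1 , 2 , 2)) + h (u ⊕ (2 , 1 , 1)))
    ≡⟨ column-column (representative agree) (representative odd₁) h u ⟨
  ⟦ agree ⟧ (⟦ odd₁ ⟧ h) u   ∎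
  where
  open ≤-Reasoning
  middle-≤ : ∀ a d {b c b′ c′} → b + c ≤ b′ + c′ → (a + b) + (c + d) ≤ (a + b′) + (c′ + d)
  middle-≤ a d {b} {c} {b′} {c′} le = begin
    (a + b) + (c + d)    ≡⟨ regroup a b c d ⟩
    a + ((b + c) + d)    ≤⟨ +-monoʳ-≤ a (+-monoˡ-≤ d le) ⟩
    a + ((b′ + c′) + d)  ≡⟨ regroup a b′ c′ d ⟨
    (a + b′) + (c′ + d)  ∎
    where
    regroup : ∀ a b c d → (a + b) + (c + d) ≡ a + ((b + c) + d)
    regroup a b c d = trans (+-assoc a b (c + d)) (cong (a +_) (sym (+-assoc b c d)))

columns : Kind → ℕ → (ℕ³ → ℕ) → ℕ³ → ℕ
columns k zero h = h
columns k (suc j) h = ⟦ k ⟧ (columns k j h)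

columns-cong : ∀ k j {f g} → f ≗ g → columns k j f ≗ columns k j g
columns-cong k zero f≗g = f≗g
columns-cong k (suc j) f≗g = column-cong (representative k) (columns-cong k j f≗g)

columns-comm : ∀ k k′ j h → ⟦ k ⟧ (columns k′ j h) ≗ columns k′ j (⟦ k ⟧ h)
columns-comm k k′ zero h u = refl
columns-comm k k′ (suc j) h u =
  trans (column-comm (representative k) (representative k′) (columns k′ j h) u)
        (column-cong (representative k′) (columns-comm k k′ j h) u)

supermodular-columns : ∀ k j {h} → Supermodular h → Supermodular (columns k j h)
supermodular-columns k zero h-super = h-super
supermodular-columns k (suc j) h-super =
  supermodular-column (representative k) (supermodular-columns k j h-super)

record Profile : Set where
  constructor ⟨_,_,_,_⟩
  field #agree #odd₁ #odd₂ #odd₃ : ℕ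

open Profile

add : Kind → Profile → Profile
add agree ⟨ a , o₁ , o₂ , o₃ ⟩ = ⟨ suc a , o₁ , o₂ , o₃ ⟩
add odd₁ ⟨ a , o₁ , o₂ , o₃ ⟩ = ⟨ a , suc o₁ , o₂ , o₃ ⟩
add odd₂ ⟨ a , o₁ , o₂ , o₃ ⟩ = ⟨ a , o₁ , suc o₂ , o₃ ⟩
add odd₃ ⟨ a , o₁ , o₂ , o₃ ⟩ = ⟨ a , o₁ , o₂ , suc o₃ ⟩

size : Profile → ℕ
size ⟨ a , o₁ , o₂ , o₃ ⟩ = a + (o₁ + (o₂ + o₃))

size-add : ∀ k P → size (add k P) ≡ suc (size P)
size-add agree P = refl
size-add odd₁ ⟨ a , o₁ , o₂ , o₃ ⟩ = +-suc a (o₁ + (o₂ + o₃))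
size-add odd₂ ⟨ a , o₁ , o₂ , o₃ ⟩ = trans (cong (a +_) (+-suc o₁ (o₂ + o₃))) (+-suc a _)
size-add odd₃ ⟨ a , o₁ , o₂ , o₃ ⟩ =
  trans (cong (λ v → a + (o₁ + v)) (+-suc o₂ o₃)) (trans (cong (a +_) (+-suc o₁ _)) (+-suc a _))

profileCount : ℕ → Profile → ℕ³ → ℕ
profileCount r ⟨ a , o₁ , o₂ , o₃ ⟩ =
  columns agree a (columns odd₁ o₁ (columns odd₂ o₂ (columns odd₃ o₃ (box r))))

profileCount-add : ∀ r k P → profileCount r (add k P) ≗ ⟦ k ⟧ (profileCount r P)
profileCount-add r agree P u = refl
profileCount-add r odd₁ ⟨ a , o₁ , o₂ , o₃ ⟩ u =
  sym (columns-comm odd₁ agree a _ u)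
profileCount-add r odd₂ ⟨ a , o₁ , o₂ , o₃ ⟩ u =
  sym (trans (columns-comm odd₂ agree a _ u) (columns-cong agree a (columns-comm odd₂ odd₁ o₁ _) u))
profileCount-add r odd₃ ⟨ a , o₁ , o₂ , o₃ ⟩ u =
  sym (trans (columns-comm odd₃ agree a _ u) (columns-cong agree a push-inside u))
  where
  push-inside : ⟦ odd₃ ⟧ (columns odd₁ o₁ (columns odd₂ o₂ (columns odd₃ o₃ (box r))))
              ≗ columns odd₁ o₁ (columns odd₂ o₂ (columns odd₃ (suc o₃) (box r)))
  push-inside v = trans (columns-comm odd₃ odd₁ o₁ _ v)
                        (columns-cong odd₁ o₁ (columns-comm odd₃ odd₂ o₂ _) v)

supermodular-profileCount : ∀ r P → Supermodular (profileCount r P)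
supermodular-profileCount r ⟨ a , o₁ , o₂ , o₃ ⟩ =
  supermodular-columns agree a (supermodular-columns odd₁ o₁
    (supermodular-columns odd₂ o₂ (supermodular-columns odd₃ o₃ (supermodular-box r))))

infix 4 _↝_ _↝*_ _↠_

data _↝_ : Profile → Profile → Set where
  settle : ∀ k {P} → add k P ↝ add agree P
  merge : ∀ {P} → add odd₂ (add odd₃ P) ↝ add agree (add odd₁ P)

_↝*_ : Profile → Profile → Set
_↝*_ = Star _↝_

↝-size : ∀ {P Q} → P ↝ Q → size P ≡ size Q
↝-size (settle k {P}) = size-add k P
↝-size (merge {P}) =
  trans (size-add odd₂ (add odd₃ P)) (cong suc (trans (size-add odd₃ P) (sym (size-add odd₁ P))))

↝*-size : ∀ {P Q} → P ↝* Q → size P ≡ size Q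
↝*-size ε = refl
↝*-size (m ◅ ms) = trans (↝-size m) (↝*-size ms)

↝-dominates : ∀ r {P Q} → P ↝ Q → profileCount r P ≤̇ profileCount r Q
↝-dominates r (settle k {P}) u = begin
  profileCount r (add k P) u      ≡⟨ profileCount-add r k P u ⟩
  ⟦ k ⟧ (profileCount r P) u
    ≤⟨ column-≤-diagonal (representative k) (supermodular-profileCount r P) u ⟩
  ⟦ agree ⟧ (profileCount r P) u  ∎
  where open ≤-Reasoning
↝-dominates r (merge {P}) u = begin
  profileCount r (add odd₂ (add odd₃ P)) u
    ≡⟨ profileCount-add r odd₂ (add odd₃ P) u ⟩
  ⟦ odd₂ ⟧ (profileCount r (add odd₃ P)) u
    ≡⟨ column-cong (representative odd₂) (profileCount-add r odd₃ P) u ⟩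
  ⟦ odd₂ ⟧ (⟦ odd₃ ⟧ (profileCount r P)) u
    ≤⟨ odd₂∘odd₃≤agree∘odd₁ (supermodular-profileCount r P) u ⟩
  ⟦ agree ⟧ (⟦ odd₁ ⟧ (profileCount r P)) u
    ≡⟨ column-cong (representative agree) (profileCount-add r odd₁ P) u ⟨
  profileCount r (add agree (add odd₁ P)) u  ∎
  where open ≤-Reasoning

↝*-dominates : ∀ r {P Q} → P ↝* Q → profileCount r P ≤̇ profileCount r Q
↝*-dominates r ε u = ≤-refl
↝*-dominates r (m ◅ ms) u = ≤-trans (↝-dominates r m u) (↝*-dominates r ms u)

_↠_ : Profile → ℕ³ → Set
P ↠ (w , p , q) = ∃[ a ] P ↝* ⟨ a , w , p , q ⟩

private variable a o₁ o₂ o₃ w p q n : ℕ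

settle-↠ : w ≤′ o₁ → p ≤′ o₂ → q ≤′ o₃ → ⟨ a , o₁ , o₂ , o₃ ⟩ ↠ (w , p , q)
settle-↠ (≤′-step w≤o₁) p≤o₂ q≤o₃ = map₂ (settle odd₁ ◅_) (settle-↠ w≤o₁ p≤o₂ q≤o₃)
settle-↠ ≤′-refl (≤′-step p≤o₂) q≤o₃ = map₂ (settle odd₂ ◅_) (settle-↠ ≤′-refl p≤o₂ q≤o₃)
settle-↠ ≤′-refl ≤′-refl (≤′-step q≤o₃) = map₂ (settle odd₃ ◅_) (settle-↠ ≤′-refl ≤′-refl q≤o₃)
settle-↠ ≤′-refl ≤′-refl ≤′-refl = _ , ε

m<n⇒n+o≰m+0 : ∀ {m n} o → m < n → ¬ (n + o ≤ m + 0)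
m<n⇒n+o≰m+0 {m} {n} o m<n n+o≤m+0 =
  <⇒≱ m<n (≤-trans (m≤m+n n o) (subst (n + o ≤_) (+-identityʳ m) n+o≤m+0))

merge-↠ : o₁ ≤‴ w → w + p ≤ o₁ + o₂ → w + q ≤ o₁ + o₃ → ⟨ a , o₁ , o₂ , o₃ ⟩ ↠ (w , p , q)
merge-↠ {w = w} ≤‴-refl w+p≤ w+q≤ =
  settle-↠ ≤′-refl (≤⇒≤′ (+-cancelˡ-≤ w _ _ w+p≤)) (≤⇒≤′ (+-cancelˡ-≤ w _ _ w+q≤))
merge-↠ {p = p} {o₂ = zero} (≤‴-step o₁<w) w+p≤ _ =
  ⊥-elim (m<n⇒n+o≰m+0 p (≤‴⇒≤ o₁<w) w+p≤)
merge-↠ {o₂ = suc _} {q = q} {o₃ = zero} (≤‴-step o₁<w) _ w+q≤ =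
  ⊥-elim (m<n⇒n+o≰m+0 q (≤‴⇒≤ o₁<w) w+q≤)
merge-↠ {o₁ = o₁} {w = w} {p = p} {o₂ = suc o₂} {q = q} {o₃ = suc o₃} (≤‴-step o₁<w) w+p≤ w+q≤ =
  map₂ (merge ◅_)
    (merge-↠ o₁<w (subst (w + p ≤_) (+-suc o₁ o₂) w+p≤) (subst (w + q ≤_) (+-suc o₁ o₃) w+q≤))

m≤1+n⇒o≤p⇒n+m≤o+p⇒m≤p : ∀ {m n o p} → m ≤ suc n → o ≤ p → n + m ≤ o + p → m ≤ p
m≤1+n⇒o≤p⇒n+m≤o+p⇒m≤p {m} {n} {o} {p} m≤1+n o≤p n+m≤o+p with m ≤? p
... | yes m≤p = m≤p
... | no m≰p = contradiction n+m≤o+p (<⇒≱ (begin-strict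
  o + p  ≤⟨ +-monoˡ-≤ p (≤-trans o≤p p≤n) ⟩
  n + p  <⟨ +-monoʳ-< n p<m ⟩
  n + m  ∎))
  where
  open ≤-Reasoning
  p<m : p < m
  p<m = ≰⇒> m≰p
  p≤n : p ≤ n
  p≤n = ≤-pred (≤-trans p<m m≤1+n)

reduce : p ≤ suc w → q ≤ suc w → o₁ ≤ o₂ → o₁ ≤ o₃ → w + p ≤ o₁ + o₂ → w + q ≤ o₁ + o₃ →
         ⟨ a , o₁ , o₂ , o₃ ⟩ ↠ (w , p , q)
reduce {w = w} {o₁ = o₁} p≤1+w q≤1+w o₁≤o₂ o₁≤o₃ w+p≤ w+q≤ with ≤-total w o₁
... | inj₁ w≤o₁ = settle-↠ (≤⇒≤′ w≤o₁)
  (≤⇒≤′ (m≤1+n⇒o≤p⇒n+m≤o+p⇒m≤p p≤1+w o₁≤o₂ w+p≤)) (≤⇒≤′ (m≤1+n⇒o≤p⇒n+m≤o+p⇒m≤p q≤1+w o₁≤o₃ w+q≤))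
... | inj₂ o₁≤w = merge-↠ (≤⇒≤‴ o₁≤w) w+p≤ w+q≤

profile : Vec Bool n → Vec Bool n → Vec Bool n → Profile
profile [] [] [] = ⟨ 0 , 0 , 0 , 0 ⟩
profile (b₁ ∷ x₁) (b₂ ∷ x₂) (b₃ ∷ x₃) = add (kind (b₁ , b₂ , b₃)) (profile x₁ x₂ x₃)

size-profile : ∀ (x₁ x₂ x₃ : Vec Bool n) → size (profile x₁ x₂ x₃) ≡ n
size-profile [] [] [] = refl
size-profile (b₁ ∷ x₁) (b₂ ∷ x₂) (b₃ ∷ x₃) =
  trans (size-add (kind (b₁ , b₂ , b₃)) (profile x₁ x₂ x₃)) (cong suc (size-profile x₁ x₂ x₃))

hamming-profile₁₂ : ∀ (x y z : Vec Bool n) → hamming x y ≡ #odd₁ (profile x y z) + #odd₂ (profile x y z)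
hamming-profile₁₂ [] [] [] = refl
hamming-profile₁₂ (false ∷ x) (false ∷ y) (false ∷ z) = hamming-profile₁₂ x y z
hamming-profile₁₂ (true ∷ x) (true ∷ y) (true ∷ z) = hamming-profile₁₂ x y z
hamming-profile₁₂ (false ∷ x) (true ∷ y) (true ∷ z) = cong suc (hamming-profile₁₂ x y z)
hamming-profile₁₂ (true ∷ x) (false ∷ y) (false ∷ z) = cong suc (hamming-profile₁₂ x y z)
hamming-profile₁₂ (false ∷ x) (true ∷ y) (false ∷ z) =
  trans (cong suc (hamming-profile₁₂ x y z)) (sym (+-suc _ _))
hamming-profile₁₂ (true ∷ x) (false ∷ y) (true ∷ z) =
  trans (cong suc (hamming-profile₁₂ x y z)) (sym (+-suc _ _))
hamming-profile₁₂ (false ∷ x) (false ∷ y) (true ∷ z) = hamming-profile₁₂ x y z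
hamming-profile₁₂ (true ∷ x) (true ∷ y) (false ∷ z) = hamming-profile₁₂ x y z

hamming-profile₁₃ : ∀ (x y z : Vec Bool n) → hamming x z ≡ #odd₁ (profile x y z) + #odd₃ (profile x y z)
hamming-profile₁₃ [] [] [] = refl
hamming-profile₁₃ (false ∷ x) (false ∷ y) (false ∷ z) = hamming-profile₁₃ x y z
hamming-profile₁₃ (true ∷ x) (true ∷ y) (true ∷ z) = hamming-profile₁₃ x y z
hamming-profile₁₃ (false ∷ x) (true ∷ y) (true ∷ z) = cong suc (hamming-profile₁₃ x y z)
hamming-profile₁₃ (true ∷ x) (false ∷ y) (false ∷ z) = cong suc (hamming-profile₁₃ x y z)
hamming-profile₁₃ (false ∷ x) (true ∷ y) (false ∷ z) = hamming-profile₁₃ x y z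
hamming-profile₁₃ (true ∷ x) (false ∷ y) (true ∷ z) = hamming-profile₁₃ x y z
hamming-profile₁₃ (false ∷ x) (false ∷ y) (true ∷ z) =
  trans (cong suc (hamming-profile₁₃ x y z)) (sym (+-suc _ _))
hamming-profile₁₃ (true ∷ x) (true ∷ y) (false ∷ z) =
  trans (cong suc (hamming-profile₁₃ x y z)) (sym (+-suc _ _))

hamming-profile₂₃ : ∀ (x y z : Vec Bool n) → hamming y z ≡ #odd₂ (profile x y z) + #odd₃ (profile x y z)
hamming-profile₂₃ [] [] [] = refl
hamming-profile₂₃ (false ∷ x) (false ∷ y) (false ∷ z) = hamming-profile₂₃ x y z
hamming-profile₂₃ (true ∷ x) (true ∷ y) (true ∷ z) = hamming-profile₂₃ x y z
hamming-profile₂₃ (false ∷ x) (true ∷ y) (true ∷ z) = hamming-profile₂₃ x y z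
hamming-profile₂₃ (true ∷ x) (false ∷ y) (false ∷ z) = hamming-profile₂₃ x y z
hamming-profile₂₃ (false ∷ x) (true ∷ y) (false ∷ z) = cong suc (hamming-profile₂₃ x y z)
hamming-profile₂₃ (true ∷ x) (false ∷ y) (true ∷ z) = cong suc (hamming-profile₂₃ x y z)
hamming-profile₂₃ (false ∷ x) (false ∷ y) (true ∷ z) =
  trans (cong suc (hamming-profile₂₃ x y z)) (sym (+-suc _ _))
hamming-profile₂₃ (true ∷ x) (true ∷ y) (false ∷ z) =
  trans (cong suc (hamming-profile₂₃ x y z)) (sym (+-suc _ _))

hamming-∷ : ∀ b c (x y : Vec Bool n) → hamming (b ∷ x) (c ∷ y) ≡ bit (c xor b) + hamming x y
hamming-∷ false false x y = refl
hamming-∷ false true x y = refl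
hamming-∷ true false x y = refl
hamming-∷ true true x y = refl

hamming-sym : ∀ (x y : Vec Bool n) → hamming x y ≡ hamming y x
hamming-sym [] [] = refl
hamming-sym (false ∷ x) (false ∷ y) = hamming-sym x y
hamming-sym (true ∷ x) (true ∷ y) = hamming-sym x y
hamming-sym (false ∷ x) (true ∷ y) = cong suc (hamming-sym x y)
hamming-sym (true ∷ x) (false ∷ y) = cong suc (hamming-sym x y)

countWithin : ∀ {A : Set} → ℕ → (A → ℕ³) → List A → ℕ
countWithin r f xs = length (filter (λ x → within? r (f x)) xs)

module _ {A : Set} (r : ℕ) where

  countWithin-cong : ∀ {f g : A → ℕ³} → f ≗ g → ∀ xs → countWithin r f xs ≡ countWithin r g xs
  countWithin-cong f≗g xs = cong length (filter-≐ _ _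
    ((λ {x} → subst (Within r) (f≗g x)) , (λ {x} → subst (Within r) (sym (f≗g x)))) xs)

  countWithin-++ : ∀ (f : A → ℕ³) xs ys →
                   countWithin r f (xs ++ ys) ≡ countWithin r f xs + countWithin r f ys
  countWithin-++ f xs ys = trans (cong length (filter-++ _ xs ys)) (length-++ (filter _ xs))

  countWithin-map : ∀ {B : Set} (f : A → ℕ³) (g : B → A) xs →
                    countWithin r f (map g xs) ≡ countWithin r (f ∘ g) xs
  countWithin-map f g [] = refl
  countWithin-map f g (x ∷ xs) with does (within? r (f (g x)))
  ... | true = cong suc (countWithin-map f g xs)
  ... | false = countWithin-map f g xs

  countWithin-singleton : ∀ (f : A → ℕ³) x → countWithin r f (x ∷ []) ≡ box r (f x)
  countWithin-singleton f x with does (within? r (f x))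
  ... | true = refl
  ... | false = refl

distances : Vec Bool n → Vec Bool n → Vec Bool n → Vec Bool n → ℕ³
distances x₁ x₂ x₃ y = (hamming x₁ y , hamming x₂ y , hamming x₃ y)

distances-∷ : ∀ b₁ b₂ b₃ c (x₁ x₂ x₃ y : Vec Bool n) →
  distances (b₁ ∷ x₁) (b₂ ∷ x₂) (b₃ ∷ x₃) (c ∷ y) ≡
  bits (c xor b₁ , c xor b₂ , c xor b₃) ⊕ distances x₁ x₂ x₃ y
distances-∷ b₁ b₂ b₃ c x₁ x₂ x₃ y =
  cong³ (hamming-∷ b₁ c x₁ y) (hamming-∷ b₂ c x₂ y) (hamming-∷ b₃ c x₃ y)

-- The size of B_{r−e₁}(x₁) ∩ B_{r−e₂}(x₂) ∩ B_{r−e₃}(x₃), where a ball of negative radius is empty.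
shiftedCount : ℕ → Vec Bool n → Vec Bool n → Vec Bool n → ℕ³ → ℕ
shiftedCount {n} r x₁ x₂ x₃ e = countWithin r (λ y → e ⊕ distances x₁ x₂ x₃ y) (allVecs n)

shiftedCount-[] : ∀ r → shiftedCount r [] [] [] ≗ box r
shiftedCount-[] r e =
  trans (countWithin-cong r {f = λ y → e ⊕ distances [] [] [] y} {g = λ _ → e} ⊕-0³ (allVecs 0))
        (countWithin-singleton r (λ _ → e) [])
  where
  ⊕-0³ : ∀ (y : Vec Bool 0) → e ⊕ distances [] [] [] y ≡ e
  ⊕-0³ [] = ⊕-identityʳ e

shiftedCount-∷ : ∀ r b₁ b₂ b₃ (x₁ x₂ x₃ : Vec Bool n) →
  shiftedCount r (b₁ ∷ x₁) (b₂ ∷ x₂) (b₃ ∷ x₃) ≗ column (b₁ , b₂ , b₃) (shiftedCount r x₁ x₂ x₃)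
shiftedCount-∷ {n} r b₁ b₂ b₃ x₁ x₂ x₃ e = begin
  countWithin r f (map (false ∷_) ys ++ map (true ∷_) ys)
    ≡⟨ countWithin-++ r f (map (false ∷_) ys) (map (true ∷_) ys) ⟩
  countWithin r f (map (false ∷_) ys) + countWithin r f (map (true ∷_) ys)
    ≡⟨ cong₂ _+_ (countWithin-map r f (false ∷_) ys) (countWithin-map r f (true ∷_) ys) ⟩
  countWithin r (f ∘ (false ∷_)) ys + countWithin r (f ∘ (true ∷_)) ys
    ≡⟨ cong₂ _+_ (countWithin-cong r (regroup false) ys) (countWithin-cong r (regroup true) ys) ⟩
  shiftedCount r x₁ x₂ x₃ (e ⊕ bits m) + shiftedCount r x₁ x₂ x₃ (e ⊕ bits (complement m))  ∎
  where
  open ≡-Reasoning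
  m : Column
  m = (b₁ , b₂ , b₃)
  ys : List (Vec Bool n)
  ys = allVecs n
  f : Vec Bool (suc n) → ℕ³
  f y = e ⊕ distances (b₁ ∷ x₁) (b₂ ∷ x₂) (b₃ ∷ x₃) y
  regroup : ∀ c y → f (c ∷ y) ≡ e ⊕ bits (c xor b₁ , c xor b₂ , c xor b₃) ⊕ distances x₁ x₂ x₃ y
  regroup c y = trans (cong (e ⊕_) (distances-∷ b₁ b₂ b₃ c x₁ x₂ x₃ y)) (sym (⊕-assoc e _ _))

shiftedCount-profile : ∀ r (x₁ x₂ x₃ : Vec Bool n) →
  shiftedCount r x₁ x₂ x₃ ≗ profileCount r (profile x₁ x₂ x₃)
shiftedCount-profile r [] [] [] = shiftedCount-[] r
shiftedCount-profile r (b₁ ∷ x₁) (b₂ ∷ x₂) (b₃ ∷ x₃) e = begin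
  shiftedCount r (b₁ ∷ x₁) (b₂ ∷ x₂) (b₃ ∷ x₃) e  ≡⟨ shiftedCount-∷ r b₁ b₂ b₃ x₁ x₂ x₃ e ⟩
  column m (shiftedCount r x₁ x₂ x₃) e            ≡⟨ column-cong m (shiftedCount-profile r x₁ x₂ x₃) e ⟩
  column m (profileCount r P) e                   ≡⟨ column-kind m (profileCount r P) e ⟩
  ⟦ kind m ⟧ (profileCount r P) e                 ≡⟨ profileCount-add r (kind m) P e ⟨
  profileCount r (add (kind m) P) e               ∎
  where
  open ≡-Reasoning
  m : Column
  m = (b₁ , b₂ , b₃)
  P : Profile
  P = profile x₁ x₂ x₃

tripleBallCount-profile : ∀ r (x₁ x₂ x₃ : Vec Bool n) →
  tripleBallCount r x₁ x₂ x₃ ≡ profileCount r (profile x₁ x₂ x₃) 0³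
tripleBallCount-profile r x₁ x₂ x₃ = shiftedCount-profile r x₁ x₂ x₃ 0³

tripleBallCount-swap₁₂ : ∀ r (x₁ x₂ x₃ : Vec Bool n) →
  tripleBallCount r x₁ x₂ x₃ ≡ tripleBallCount r x₂ x₁ x₃
tripleBallCount-swap₁₂ {n} r x₁ x₂ x₃ = cong length (filter-≐ _ _
  ((λ (d₁ , d₂ , d₃) → d₂ , d₁ , d₃) , (λ (d₂ , d₁ , d₃) → d₁ , d₂ , d₃)) (allVecs n))

tripleBallCount-reverse : ∀ r (x₁ x₂ x₃ : Vec Bool n) →
  tripleBallCount r x₁ x₂ x₃ ≡ tripleBallCount r x₃ x₂ x₁
tripleBallCount-reverse {n} r x₁ x₂ x₃ = cong length (filter-≐ _ _
  ((λ (d₁ , d₂ , d₃) → d₃ , d₂ , d₁) , (λ (d₃ , d₂ , d₁) → d₁ , d₂ , d₃)) (allVecs n))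

admissible-swap₁₂ : ∀ {k} (x₁ x₂ x₃ : Vec Bool n) → Admissible k x₁ x₂ x₃ → Admissible k x₂ x₁ x₃
admissible-swap₁₂ x₁ x₂ x₃ (k≤d₁₂ , k≤d₁₃ , k≤d₂₃) =
  subst (_ ≤_) (hamming-sym x₁ x₂) k≤d₁₂ , k≤d₂₃ , k≤d₁₃

admissible-reverse : ∀ {k} (x₁ x₂ x₃ : Vec Bool n) → Admissible k x₁ x₂ x₃ → Admissible k x₃ x₂ x₁
admissible-reverse x₁ x₂ x₃ (k≤d₁₂ , k≤d₁₃ , k≤d₂₃) =
  subst (_ ≤_) (hamming-sym x₂ x₃) k≤d₂₃ ,
  subst (_ ≤_) (hamming-sym x₁ x₃) k≤d₁₃ ,
  subst (_ ≤_) (hamming-sym x₁ x₂) k≤d₁₂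

greatest-of-three : ∀ a b c → (a ≤ c × b ≤ c) ⊎ (a ≤ b × c ≤ b) ⊎ (b ≤ a × c ≤ a)
greatest-of-three a b c with ≤-total b c
greatest-of-three a b c | inj₁ b≤c with ≤-total a c
... | inj₁ a≤c = inj₁ (a≤c , b≤c)
... | inj₂ c≤a = inj₂ (inj₂ (≤-trans b≤c c≤a , c≤a))
greatest-of-three a b c | inj₂ c≤b with ≤-total a b
... | inj₁ a≤b = inj₂ (inj₁ (a≤b , c≤b))
... | inj₂ b≤a = inj₂ (inj₂ (b≤a , ≤-trans c≤b b≤a))

Triple : ℕ → Set
Triple n = Vec Bool n × Vec Bool n × Vec Bool n

infixr 5 _∷³_

_∷³_ : Column → Triple n → Triple (suc n)
(b₁ , b₂ , b₃) ∷³ (x₁ , x₂ , x₃) = (b₁ ∷ x₁ , b₂ ∷ x₂ , b₃ ∷ x₃)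

realise : (P : Profile) → Triple (size P)
realise ⟨ suc a , o₁ , o₂ , o₃ ⟩ = representative agree ∷³ realise ⟨ a , o₁ , o₂ , o₃ ⟩
realise ⟨ zero , suc o₁ , o₂ , o₃ ⟩ = representative odd₁ ∷³ realise ⟨ zero , o₁ , o₂ , o₃ ⟩
realise ⟨ zero , zero , suc o₂ , o₃ ⟩ = representative odd₂ ∷³ realise ⟨ zero , zero , o₂ , o₃ ⟩
realise ⟨ zero , zero , zero , suc o₃ ⟩ = representative odd₃ ∷³ realise ⟨ zero , zero , zero , o₃ ⟩
realise ⟨ zero , zero , zero , zero ⟩ = ([] , [] , [])

profile³ : Triple n → Profile
profile³ (x₁ , x₂ , x₃) = profile x₁ x₂ x₃

profile-realise : ∀ P → profile³ (realise P) ≡ P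
profile-realise ⟨ suc a , o₁ , o₂ , o₃ ⟩ = cong (add agree) (profile-realise ⟨ a , o₁ , o₂ , o₃ ⟩)
profile-realise ⟨ zero , suc o₁ , o₂ , o₃ ⟩ = cong (add odd₁) (profile-realise ⟨ zero , o₁ , o₂ , o₃ ⟩)
profile-realise ⟨ zero , zero , suc o₂ , o₃ ⟩ =
  cong (add odd₂) (profile-realise ⟨ zero , zero , o₂ , o₃ ⟩)
profile-realise ⟨ zero , zero , zero , suc o₃ ⟩ =
  cong (add odd₃) (profile-realise ⟨ zero , zero , zero , o₃ ⟩)
profile-realise ⟨ zero , zero , zero , zero ⟩ = refl

module _ (r k w p : ℕ) (w≤p : w ≤ p) (p≤1+w : p ≤ suc w) (k≡w+p : k ≡ w + p) where

  target : ℕ → Profile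
  target a = ⟨ a , w , p , p ⟩

  Dominated : ℕ → ℕ → Set
  Dominated n c = ∃[ a ] size (target a) ≡ n × c ≤ profileCount r (target a) 0³

  dominated-sorted : ∀ (x₁ x₂ x₃ : Vec Bool n) → Admissible k x₁ x₂ x₃ →
    hamming x₁ x₂ ≤ hamming x₂ x₃ → hamming x₁ x₃ ≤ hamming x₂ x₃ →
    Dominated n (tripleBallCount r x₁ x₂ x₃)
  dominated-sorted x₁ x₂ x₃ (k≤d₁₂ , k≤d₁₃ , _) d₁₂≤d₂₃ d₁₃≤d₂₃ =
    let a , path = reduce {a = #agree P} p≤1+w p≤1+w o₁≤o₂ o₁≤o₃ w+p≤o₁+o₂ w+p≤o₁+o₃ in
    a , trans (sym (↝*-size path)) (size-profile x₁ x₂ x₃) ,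
    ≤-trans (≤-reflexive (tripleBallCount-profile r x₁ x₂ x₃)) (↝*-dominates r path 0³)
    where
    P : Profile
    P = profile x₁ x₂ x₃
    o₁≤o₂ : #odd₁ P ≤ #odd₂ P
    o₁≤o₂ = +-cancelʳ-≤ (#odd₃ P) _ _
      (subst₂ _≤_ (hamming-profile₁₃ x₁ x₂ x₃) (hamming-profile₂₃ x₁ x₂ x₃) d₁₃≤d₂₃)
    o₁≤o₃ : #odd₁ P ≤ #odd₃ P
    o₁≤o₃ = +-cancelˡ-≤ (#odd₂ P) _ _
      (subst₂ _≤_ (trans (hamming-profile₁₂ x₁ x₂ x₃) (+-comm (#odd₁ P) _))
                  (hamming-profile₂₃ x₁ x₂ x₃) d₁₂≤d₂₃)
    w+p≤o₁+o₂ : w + p ≤ #odd₁ P + #odd₂ P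
    w+p≤o₁+o₂ = subst₂ _≤_ k≡w+p (hamming-profile₁₂ x₁ x₂ x₃) k≤d₁₂
    w+p≤o₁+o₃ : w + p ≤ #odd₁ P + #odd₃ P
    w+p≤o₁+o₃ = subst₂ _≤_ k≡w+p (hamming-profile₁₃ x₁ x₂ x₃) k≤d₁₃

  dominated : ∀ (x₁ x₂ x₃ : Vec Bool n) → Admissible k x₁ x₂ x₃ →
    Dominated n (tripleBallCount r x₁ x₂ x₃)
  dominated x₁ x₂ x₃ adm with greatest-of-three (hamming x₁ x₂) (hamming x₁ x₃) (hamming x₂ x₃)
  ... | inj₁ (d₁₂≤d₂₃ , d₁₃≤d₂₃) = dominated-sorted x₁ x₂ x₃ adm d₁₂≤d₂₃ d₁₃≤d₂₃
  ... | inj₂ (inj₁ (d₁₂≤d₁₃ , d₂₃≤d₁₃)) =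
    subst (Dominated _) (sym (tripleBallCount-swap₁₂ r x₁ x₂ x₃))
      (dominated-sorted x₂ x₁ x₃ (admissible-swap₁₂ x₁ x₂ x₃ adm)
        (subst (_≤ _) (hamming-sym x₁ x₂) d₁₂≤d₁₃) d₂₃≤d₁₃)
  ... | inj₂ (inj₂ (d₁₃≤d₁₂ , d₂₃≤d₁₂)) =
    subst (Dominated _) (sym (tripleBallCount-reverse r x₁ x₂ x₃))
      (dominated-sorted x₃ x₂ x₁ (admissible-reverse x₁ x₂ x₃ adm)
        (subst₂ _≤_ (hamming-sym x₂ x₃) (hamming-sym x₁ x₂) d₂₃≤d₁₂)
        (subst₂ _≤_ (hamming-sym x₁ x₃) (hamming-sym x₁ x₂) d₁₃≤d₁₂))

  target-optimal : ∀ {a} (x₁ x₂ x₃ : Vec Bool n) → profile x₁ x₂ x₃ ≡ target a →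
    IsMaximizer r k x₁ x₂ x₃ × hamming x₁ x₂ ≡ k × hamming x₁ x₃ ≡ k × hamming x₂ x₃ ≡ p + p
  target-optimal {n = n} {a = a} x₁ x₂ x₃ P≡target =
    (admissible , maximal) , d₁₂≡k , d₁₃≡k , d₂₃≡p+p
    where
    d₁₂≡k : hamming x₁ x₂ ≡ k
    d₁₂≡k = trans (hamming-profile₁₂ x₁ x₂ x₃)
                  (trans (cong (λ P → #odd₁ P + #odd₂ P) P≡target) (sym k≡w+p))
    d₁₃≡k : hamming x₁ x₃ ≡ k
    d₁₃≡k = trans (hamming-profile₁₃ x₁ x₂ x₃)
                  (trans (cong (λ P → #odd₁ P + #odd₃ P) P≡target) (sym k≡w+p))
    d₂₃≡p+p : hamming x₂ x₃ ≡ p + p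
    d₂₃≡p+p = trans (hamming-profile₂₃ x₁ x₂ x₃) (cong (λ P → #odd₂ P + #odd₃ P) P≡target)
    admissible : Admissible k x₁ x₂ x₃
    admissible = ≤-reflexive (sym d₁₂≡k) , ≤-reflexive (sym d₁₃≡k) ,
      subst₂ _≤_ (sym k≡w+p) (sym d₂₃≡p+p) (+-monoˡ-≤ p w≤p)
    size-target : size (target a) ≡ n
    size-target = trans (cong size (sym P≡target)) (size-profile x₁ x₂ x₃)
    maximal : ∀ y₁ y₂ y₃ → Admissible k y₁ y₂ y₃ →
              tripleBallCount r y₁ y₂ y₃ ≤ tripleBallCount r x₁ x₂ x₃
    maximal y₁ y₂ y₃ adm with dominated y₁ y₂ y₃ adm
    ... | a′ , size≡n , bounded = begin
      tripleBallCount r y₁ y₂ y₃            ≤⟨ bounded ⟩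
      profileCount r (target a′) 0³         ≡⟨ cong (λ b → profileCount r (target b) 0³) a′≡a ⟩
      profileCount r (target a) 0³          ≡⟨ cong (λ P → profileCount r P 0³) P≡target ⟨
      profileCount r (profile x₁ x₂ x₃) 0³  ≡⟨ tripleBallCount-profile r x₁ x₂ x₃ ⟨
      tripleBallCount r x₁ x₂ x₃            ∎
      where
      open ≤-Reasoning
      a′≡a : a′ ≡ a
      a′≡a = +-cancelʳ-≡ (w + (p + p)) a′ a (trans size≡n (sym size-target))

  optimal-triple : (∃[ x₁ ] ∃[ x₂ ] ∃[ x₃ ] Admissible {n} k x₁ x₂ x₃) →
    ∃[ x₁ ] ∃[ x₂ ] ∃[ x₃ ] (IsMaximizer {n} r k x₁ x₂ x₃ ×
      hamming x₁ x₂ ≡ k × hamming x₁ x₃ ≡ k × hamming x₂ x₃ ≡ p + p)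
  optimal-triple (y₁ , y₂ , y₃ , adm) with dominated y₁ y₂ y₃ adm
  ... | a , refl , _ = let x₁ , x₂ , x₃ = realise (target a) in
    x₁ , x₂ , x₃ , target-optimal x₁ x₂ x₃ (profile-realise (target a))

lemma1 : (n r k : ℕ) → 1 ≤ n → r ≤ n → 1 ≤ k → k ≤ n →
    (∃[ x₁ ] ∃[ x₂ ] ∃[ x₃ ] Admissible {n} k x₁ x₂ x₃) →
    ((t : ℕ) → k ≡ 2 * t →
      ∃[ x₁ ] ∃[ x₂ ] ∃[ x₃ ] (IsMaximizer {n} r k x₁ x₂ x₃ ×
        hamming x₁ x₂ ≡ k × hamming x₁ x₃ ≡ k × hamming x₂ x₃ ≡ k))
    ×
    ((t : ℕ) → k ≡ suc (2 * t) →
      ∃[ x₁ ] ∃[ x₂ ] ∃[ x₃ ] (IsMaximizer {n} r k x₁ x₂ x₃ ×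
        ((hamming x₁ x₂ ≡ k × hamming x₁ x₃ ≡ k × hamming x₂ x₃ ≡ k + 1)
         ⊎ (hamming x₁ x₂ ≡ k × hamming x₁ x₃ ≡ k + 1 × hamming x₂ x₃ ≡ k)
         ⊎ (hamming x₁ x₂ ≡ k + 1 × hamming x₁ x₃ ≡ k × hamming x₂ x₃ ≡ k))))
lemma1 n r k _ _ _ _ admissible =
  (λ t k≡2t →
    let k≡t+t = trans k≡2t (cong (t +_) (+-identityʳ t))
        x₁ , x₂ , x₃ , maximizer , d₁₂ , d₁₃ , d₂₃ =
          optimal-triple r k t t ≤-refl (n≤1+n t) k≡t+t admissible
    in x₁ , x₂ , x₃ , maximizer , d₁₂ , d₁₃ , trans d₂₃ (sym k≡t+t)) ,
  (λ t k≡1+2t →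
    let k≡t+1+t = trans k≡1+2t (trans (cong (λ m → suc (t + m)) (+-identityʳ t)) (sym (+-suc t t)))
        x₁ , x₂ , x₃ , maximizer , d₁₂ , d₁₃ , d₂₃ =
          optimal-triple r k t (suc t) (n≤1+n t) ≤-refl k≡t+1+t admissible
    in x₁ , x₂ , x₃ , maximizer ,
       inj₁ (d₁₂ , d₁₃ , trans d₂₃ (trans (cong suc (sym k≡t+1+t)) (+-comm 1 k))))
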